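{- For every positive integer $k$, $\gamma'_{\rm SMB}(F'_k)=k+1$ and $\gamma_{\rm SMB}(F'_k)=\infty$.
   Context: Graphs $F_k$ with distinguished sets are defined recursively. $F_1$ is the path $P_3$, $X_1$ is the set of its two leaves and $z_1$ its central vertex. For $k\ge 2$, $F_k$ is obtained from two disjoint copies $F_{k-1}^1,F_{k-1}^2$ of $F_{k-1}$ (with corresponding copies $X_{k-1}^1,X_{k-1}^2$ of $X_{k-1}$) by adding a new vertex $z_k$ adjacent to every vertex of $X_{k-1}^1\cup X_{k-1}^2$; set $X_k=X_{k-1}^1\cup X_{k-1}^2$ and $Y_k=V(F_k)\setminus(X_k\cup\{z_k\})$. Define $F'_1=F_1$, $F'_2=F_2$, and for $k\ge 3$ let $F'_k$ be obtained from $F_k$ by adding a complete graph on a new set $Y_k^+$ of $k-1$ vertices and joining every vertex of $Y_k^+$ to every vertex of $Y_k$. The Maker-Breaker domination game on a graph $G$ is played by Dominator and Staller, who alternately play a vertex not played before. Dominator wins if the set of vertices he has played is a dominating set of $G$; Staller wins if she has played all vertices of the closed neighborhood $N_G[v]$ for some $v\in V(G)$. In the D-game Dominator moves first, in the S-game Staller moves first. $\gamma_{\rm SMB}(G)$ (resp. $\gamma'_{\rm SMB}(G)$) is the smallest integer $m$ such that in the D-game (resp. S-game), under any strategy of Dominator, Staller can win having played at most $m$ vertices; the value is $\infty$ if Staller has no winning strategy. -}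

module Defs where

open import Data.Nat using (ℕ; zero; suc; _<_)
open import Data.Fin using (Fin)
open import Data.Unit using (⊤)
open import Data.Empty using (⊥)
open import Data.Sum using (_⊎_; inj₁; inj₂)
open import Data.Product using (Σ; _×_)
open import Data.List using (List; []; _∷_)
open import Data.List.Membership.Propositional using (_∈_; _∉_)
open import Relation.Nullary using (¬_)
open import Relation.Binary.PropositionalEquality using (_≡_; _≢_)

record Graph : Set₁ where
  field
    V   : Set
    Adj : V → V → Set

module Game (G : Graph) where
  open Graph G

  InN : V → V → Set
  InN v u = (u ≡ v) ⊎ Adj v u

  DomWon : List V → Set
  DomWon D = (v : V) → Σ V (λ u → InN v u × u ∈ D)

  StaWon : List V → Set
  StaWon S = Σ V (λ v → (u : V) → InN v u → u ∈ S)

  Free : List V → List V → V → Set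
  Free D S u = u ∉ D × u ∉ S

  mutual
    -- Staller to move (D = Dominator's vertices, S = Staller's vertices);
    -- Staller has a strategy that wins against every Dominator strategy
    -- while playing at most m further vertices.
    SWinS : ℕ → List V → List V → Set
    SWinS zero    D S = ⊥
    SWinS (suc m) D S =
      Σ V (λ u → Free D S u × (StaWon (u ∷ S) ⊎ SWinD m D (u ∷ S)))

    SWinD : ℕ → List V → List V → Set
    SWinD m D S =
      ¬ DomWon D ×
      ((u : V) → Free D S u → ¬ DomWon (u ∷ D) × SWinS m (u ∷ D) S)

  -- γ_SMB(G) = m  (D-game, Dominator starts)
  γSMB≡ : ℕ → Set
  γSMB≡ m = SWinD m [] [] × ((m′ : ℕ) → m′ < m → ¬ SWinD m′ [] [])

  γSMB≡∞ : Set
  γSMB≡∞ = (m : ℕ) → ¬ SWinD m [] []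

  -- γ'_SMB(G) = m  (S-game, Staller starts)
  γ′SMB≡ : ℕ → Set
  γ′SMB≡ m = SWinS m [] [] × ((m′ : ℕ) → m′ < m → ¬ SWinS m′ [] [])

  γ′SMB≡∞ : Set
  γ′SMB≡∞ = (m : ℕ) → ¬ SWinS m [] []

-- The graphs F_k.  Index convention: VF n is the vertex type of F_{n+1}.

data VF : ℕ → Set where
  leafL leafR center : VF zero            -- F_1 = P_3
  top   : ∀ {n} → VF (suc n)               -- z_{n+2}
  left  : ∀ {n} → VF n → VF (suc n)
  right : ∀ {n} → VF n → VF (suc n)

X : (n : ℕ) → VF n → Set
X zero    leafL     = ⊤
X zero    leafR     = ⊤
X zero    center    = ⊥
X (suc n) top       = ⊥
X (suc n) (left v)  = X n v
X (suc n) (right v) = X n v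

IsZ : (n : ℕ) → VF n → Set
IsZ zero    center = ⊤
IsZ zero    leafL  = ⊥
IsZ zero    leafR  = ⊥
IsZ (suc n) top    = ⊤
IsZ (suc n) (left _)  = ⊥
IsZ (suc n) (right _) = ⊥

Y : (n : ℕ) → VF n → Set
Y n v = ¬ X n v × ¬ IsZ n v

EF : (n : ℕ) → VF n → VF n → Set
EF zero    leafL  center = ⊤
EF zero    leafR  center = ⊤
EF zero    center leafL  = ⊤
EF zero    center leafR  = ⊤
EF zero    _      _      = ⊥
EF (suc n) (left u)  (left v)  = EF n u v
EF (suc n) (right u) (right v) = EF n u v
EF (suc n) top       (left v)  = X n v
EF (suc n) top       (right v) = X n v
EF (suc n) (left u)  top       = X n u
EF (suc n) (right u) top       = X n u
EF (suc n) _         _         = ⊥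

-- number of extra vertices |Y^+_{n+1}| : 0 for k = n+1 ∈ {1,2}, k-1 = n for k ≥ 3
extra : ℕ → ℕ
extra zero          = zero
extra (suc zero)    = zero
extra (suc (suc m)) = suc (suc m)

-- adjacency of F'_{n+1}: vertices VF n ⊎ Fin (extra n), the Fin part being Y^+
EF′ : (n : ℕ) → VF n ⊎ Fin (extra n) → VF n ⊎ Fin (extra n) → Set
EF′ n (inj₁ u) (inj₁ v) = EF n u v
EF′ n (inj₂ i) (inj₂ j) = i ≢ j
EF′ n (inj₂ i) (inj₁ v) = Y n v
EF′ n (inj₁ u) (inj₂ j) = Y n u

-- F'_k for k = n + 1
F′ : ℕ → Graph
F′ n = record { V = VF n ⊎ Fin (extra n) ; Adj = EF′ n }

-- Every closed neighbourhood of F′ₖ has at least k + 1 vertices, so Staller needs k + 1 moves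
-- to win, and in the S-game Dominator cannot prevent her from reaching that bound: she plays
-- z_k, and whenever Dominator answers she moves into a copy of F_{k-1} he has not touched and
-- plays its top vertex; after descending to a copy of P₃ she plays its centre and then an
-- untouched leaf, whose closed neighbourhood consists of the leaf, the centre and the tops
-- she has played.  In the D-game Dominator plays z_k and then dominates the rest with one
-- vertex of Y⁺ₖ (k ≥ 3), or with a vertex next to each centre of the two copies of P₃ (k = 2).

module Submission where

open import Defs
open import Data.Empty using (⊥-elim)
open import Data.Fin using (Fin; zero; suc)
open import Data.Fin.Properties using (injective⇒≤; ¬∀⟶∃¬) renaming (_≟_ to _≟ᶠ_)
open import Data.List using (List; []; _∷_; length; _++_; lookup)
open import Data.List.Membership.Propositional using (_∈_; _∉_)
open import Data.List.Membership.Propositional.Properties using (∈-++⁺ˡ; ∈-++⁺ʳ)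
open import Data.List.Properties using (length-++)
open import Data.List.Relation.Unary.Any using (here; there; index; any?)
open import Data.List.Relation.Unary.Any.Properties using (lookup-index)
open import Data.Nat using (ℕ; zero; suc; _+_; _≤_; _<_; z≤n; s≤s; s≤s⁻¹)
open import Data.Nat.Properties
  using (+-suc; +-mono-≤; +-monoˡ-≤; +-monoʳ-≤; m<m+n; ≤-trans; <⇒≱; module ≤-Reasoning)
open import Data.Product using (Σ; _×_; _,_; proj₁; proj₂)
open import Data.Sum using (_⊎_; inj₁; inj₂)
open import Data.Sum.Properties using (inj₁-injective; inj₂-injective; ≡-dec)
open import Data.Unit using (tt)
open import Data.Vec.Functional using () renaming (_∷_ to infixr 5 _◂_)
open import Function using (_∘_)
open import Function.Definitions using (Injective)
open import Relation.Binary.Definitions using (DecidableEquality)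
open import Relation.Binary.PropositionalEquality
open import Relation.Nullary using (¬_; yes; no; Dec)
open import Relation.Nullary.Decidable using (map′)

◂-injective : ∀ {A : Set} {k} {a : A} {g : Fin k → A} →
              (∀ i → a ≢ g i) → Injective _≡_ _≡_ g → Injective _≡_ _≡_ (a ◂ g)
◂-injective a∉g g-inj {zero}  {zero}  _ = refl
◂-injective a∉g g-inj {zero}  {suc j} e = ⊥-elim (a∉g j e)
◂-injective a∉g g-inj {suc i} {zero}  e = ⊥-elim (a∉g i (sym e))
◂-injective a∉g g-inj {suc i} {suc j} e = cong suc (g-inj e)

injective⇒≤-length : ∀ {A : Set} {k} {f : Fin k → A} {L : List A} →
                     Injective _≡_ _≡_ f → (∀ i → f i ∈ L) → k ≤ length L
injective⇒≤-length {f = f} {L} f-inj f∈L = injective⇒≤ position-injective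
  where
  open ≡-Reasoning
  position-injective : Injective _≡_ _≡_ (λ i → index (f∈L i))
  position-injective {i} {j} eq = f-inj (begin
    f i                      ≡⟨ lookup-index (f∈L i) ⟩
    lookup L (index (f∈L i)) ≡⟨ cong (lookup L) eq ⟩
    lookup L (index (f∈L j)) ≡⟨ lookup-index (f∈L j) ⟨
    f j                      ∎)

fresh : ∀ {A : Set} {N} {f : Fin N → A} → DecidableEquality A → Injective _≡_ _≡_ f →
        (L : List A) → length L < N → Σ A (_∉ L)
fresh {N = N} {f} _≟_ f-inj L |L|<N
  with i , fi∉L ← ¬∀⟶∃¬ N (λ i → f i ∈ L) (λ i → any? (f i ≟_) L)
                    (λ all∈L → <⇒≱ |L|<N (injective⇒≤-length f-inj all∈L))
  = f i , fi∉L

m+[1+n]<o⇒2+m≤o : ∀ {m n o} → m + suc n < o → 2 + m ≤ o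
m+[1+n]<o⇒2+m≤o {m} short = ≤-trans (s≤s (m<m+n m (s≤s z≤n))) short

roomForDominator : ∀ {a b m r N} → a ≤ b → b + suc m < r → r + r ≤ 2 + N → a + suc b < N
roomForDominator {a} {b} {r = r} {N} a≤b short enough = s≤s⁻¹ (s≤s⁻¹ (begin
  3 + (a + suc b)           ≤⟨ +-monoʳ-≤ 3 (+-monoˡ-≤ (suc b) a≤b) ⟩
  3 + (b + suc b)           ≡⟨ cong (2 +_) (+-suc b (suc b)) ⟨
  (2 + b) + (2 + b)         ≤⟨ +-mono-≤ (m+[1+n]<o⇒2+m≤o short) (m+[1+n]<o⇒2+m≤o short) ⟩
  r + r                     ≤⟨ enough ⟩
  2 + N                     ∎))
  where open ≤-Reasoning

-- The game on an arbitrary graph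

module GameFacts (G : Graph) where
  open Graph G
  open Game G

  NbhdOfSize : ℕ → V → Set
  NbhdOfSize r v = Σ (Fin r → V) (λ f → Injective _≡_ _≡_ f × (∀ i → InN v (f i)))

  withSelf : (∀ u → ¬ Adj u u) → ∀ {k v} {f : Fin k → V} →
             Injective _≡_ _≡_ f → (∀ i → Adj v (f i)) → NbhdOfSize (suc k) v
  withSelf irreflexive {v = v} {f} f-inj v~f =
    v ◂ f ,
    ◂-injective (λ i v≡fi → irreflexive v (subst (Adj v) (sym v≡fi) (v~f i))) f-inj ,
    λ { zero → inj₁ refl ; (suc i) → inj₂ (v~f i) }

  ¬DomWon-if-undominated : ∀ {D} v → (∀ u → InN v u → u ∉ D) → ¬ DomWon D
  ¬DomWon-if-undominated v undominated dom =
    let u , v~u , u∈D = dom v in undominated u v~u u∈D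

  ¬SWinD-by-dominating : ∀ {D S u} → Free D S u → DomWon (u ∷ D) → ∀ m → ¬ SWinD m D S
  ¬SWinD-by-dominating free dom m (_ , answer) = proj₁ (answer _ free) dom

  ¬SWinD-by-move : ∀ {D S u} → Free D S u → (∀ m → ¬ SWinS m (u ∷ D) S) → ∀ m → ¬ SWinD m D S
  ¬SWinD-by-move free refute m (_ , answer) = refute m (proj₂ (answer _ free))

  ¬SWinS-by-answers : ∀ {D S} →
    (∀ s → Free D S s → ¬ StaWon (s ∷ S) × (∀ m → ¬ SWinD m D (s ∷ S))) → ∀ m → ¬ SWinS m D S
  ¬SWinS-by-answers answers zero ()
  ¬SWinS-by-answers answers (suc m) (s , free , inj₁ won) = proj₁ (answers s free) won
  ¬SWinS-by-answers answers (suc m) (s , free , inj₂ win) = proj₂ (answers s free) m win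

  module _ {r : ℕ} (nbhd : ∀ v → NbhdOfSize r v) where

    StaWon⇒≤ : ∀ {S} → StaWon S → r ≤ length S
    StaWon⇒≤ (v , N[v]⊆S) =
      let f , f-inj , f∈N[v] = nbhd v in injective⇒≤-length f-inj (λ i → N[v]⊆S (f i) (f∈N[v] i))

    ¬StaWon-short : ∀ {S} → length S < r → ¬ StaWon S
    ¬StaWon-short short won = <⇒≱ short (StaWon⇒≤ won)

    module _ (_≟_ : DecidableEquality V) {N} {f : Fin N → V} (f-inj : Injective _≡_ _≡_ f)
             (enough : r + r ≤ 2 + N) where

      -- Dominator's moves are arbitrary; the vertex count only guarantees that he can move.
      ¬SWinS-short : ∀ m {D S} → length S + m < r → length D ≤ length S → ¬ SWinS m D S
      ¬SWinS-short zero _ _ ()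
      ¬SWinS-short (suc m) short _ (_ , _ , inj₁ won) =
        ¬StaWon-short (m+[1+n]<o⇒2+m≤o short) won
      ¬SWinS-short (suc m) {D} {S} short |D|≤|S| (s , _ , inj₂ (_ , answer))
        with d , d∉ ← fresh _≟_ f-inj (D ++ s ∷ S)
                        (subst (_< N) (sym (length-++ D)) (roomForDominator |D|≤|S| short enough))
        = ¬SWinS-short m (subst (_< r) (+-suc (length S) m) short) (s≤s |D|≤|S|)
                       (proj₂ (answer d (d∉ ∘ ∈-++⁺ˡ , d∉ ∘ ∈-++⁺ʳ D)))

-- The graphs F_{n+1} and F′_{n+1}

F : ℕ → Graph
F n = record { V = VF n ; Adj = EF n }

V′ : ℕ → Set
V′ n = Graph.V (F′ n)

data Side : Set where
  leftSide rightSide : Side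

copy : ∀ {j} → Side → VF j → VF (suc j)
copy leftSide  = left
copy rightSide = right

copy-injective : ∀ {j} σ → Injective _≡_ _≡_ (copy {j} σ)
copy-injective leftSide  refl = refl
copy-injective rightSide refl = refl

copy-≢top : ∀ {j} σ (w : VF j) → copy σ w ≢ top
copy-≢top leftSide  w ()
copy-≢top rightSide w ()

copy-image? : ∀ {j} σ (w : VF (suc j)) →
              Σ (VF j) (λ w′ → w ≡ copy σ w′) ⊎ (∀ w′ → w ≢ copy σ w′)
copy-image? leftSide  (left w)  = inj₁ (w , refl)
copy-image? rightSide (right w) = inj₁ (w , refl)
copy-image? leftSide  (right w) = inj₂ (λ _ ())
copy-image? rightSide (left w)  = inj₂ (λ _ ())
copy-image? σ         top       = inj₂ (λ w′ e → copy-≢top σ w′ (sym e))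

copy-adj : ∀ {j} σ {x w : VF j} → EF j x w → EF (suc j) (copy σ x) (copy σ w)
copy-adj leftSide  x~w = x~w
copy-adj rightSide x~w = x~w

copy-InN : ∀ {j} σ {x w : VF j} → Game.InN (F j) x w → Game.InN (F (suc j)) (copy σ x) (copy σ w)
copy-InN σ (inj₁ refl) = inj₁ refl
copy-InN σ (inj₂ x~w)  = inj₂ (copy-adj σ x~w)

copy-nbhd : ∀ {j} σ (x : VF j) (w : VF (suc j)) → Game.InN (F (suc j)) (copy σ x) w →
            Σ (VF j) (λ w′ → w ≡ copy σ w′ × Game.InN (F j) x w′) ⊎ w ≡ top
copy-nbhd σ         x _         (inj₁ refl) = inj₁ (x , refl , inj₁ refl)
copy-nbhd σ         x top       (inj₂ _)    = inj₂ refl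
copy-nbhd leftSide  x (left w)  (inj₂ x~w)  = inj₁ (w , refl , inj₂ x~w)
copy-nbhd rightSide x (right w) (inj₂ x~w)  = inj₁ (w , refl , inj₂ x~w)
copy-nbhd leftSide  x (right w) (inj₂ ())
copy-nbhd rightSide x (left w)  (inj₂ ())

copy-X : ∀ {j} σ {x : VF j} → X j x → X (suc j) (copy σ x)
copy-X leftSide  x∈X = x∈X
copy-X rightSide x∈X = x∈X

copy-Y : ∀ {j} σ {x : VF j} → ¬ X j x → Y (suc j) (copy σ x)
copy-Y leftSide  x∉X = x∉X , λ ()
copy-Y rightSide x∉X = x∉X , λ ()

copy-adj-top : ∀ {j} σ {x : VF j} → X j x → EF (suc j) (copy σ x) top
copy-adj-top leftSide  x∈X = x∈X
copy-adj-top rightSide x∈X = x∈X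

inj₁-InN : ∀ {n} {x w : VF n} → Game.InN (F n) x w → Game.InN (F′ n) (inj₁ x) (inj₁ w)
inj₁-InN (inj₁ refl) = inj₁ refl
inj₁-InN (inj₂ x~w)  = inj₂ x~w

EF-irreflexive : ∀ n (x : VF n) → ¬ EF n x x
EF-irreflexive zero    leafL     ()
EF-irreflexive zero    leafR     ()
EF-irreflexive zero    center    ()
EF-irreflexive (suc n) top       ()
EF-irreflexive (suc n) (left x)  = EF-irreflexive n x
EF-irreflexive (suc n) (right x) = EF-irreflexive n x

EF′-irreflexive : ∀ n (v : V′ n) → ¬ EF′ n v v
EF′-irreflexive n (inj₁ x)     = EF-irreflexive n x
EF′-irreflexive n (inj₂ i) i≢i = i≢i refl

X? : ∀ n (v : VF n) → Dec (X n v)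
X? zero    leafL     = yes tt
X? zero    leafR     = yes tt
X? zero    center    = no (λ ())
X? (suc n) top       = no (λ ())
X? (suc n) (left v)  = X? n v
X? (suc n) (right v) = X? n v

IsZ? : ∀ n (v : VF n) → Dec (IsZ n v)
IsZ? zero    leafL     = no (λ ())
IsZ? zero    leafR     = no (λ ())
IsZ? zero    center    = yes tt
IsZ? (suc n) top       = yes tt
IsZ? (suc n) (left v)  = no (λ ())
IsZ? (suc n) (right v) = no (λ ())

_≟V_ : ∀ {n} → DecidableEquality (VF n)
leafL   ≟V leafL   = yes refl
leafL   ≟V leafR   = no (λ ())
leafL   ≟V center  = no (λ ())
leafR   ≟V leafL   = no (λ ())
leafR   ≟V leafR   = yes refl
leafR   ≟V center  = no (λ ())
center  ≟V leafL   = no (λ ())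
center  ≟V leafR   = no (λ ())
center  ≟V center  = yes refl
top     ≟V top     = yes refl
top     ≟V left _  = no (λ ())
top     ≟V right _ = no (λ ())
left _  ≟V top     = no (λ ())
left a  ≟V left b  = map′ (cong left) (copy-injective leftSide) (a ≟V b)
left _  ≟V right _ = no (λ ())
right _ ≟V top     = no (λ ())
right _ ≟V left _  = no (λ ())
right a ≟V right b = map′ (cong right) (copy-injective rightSide) (a ≟V b)

leaves : ∀ n → Fin (suc n) → VF n
leaves zero    _ = leafL
leaves (suc n)   = right (leaves n zero) ◂ left ∘ leaves n

leaves-X : ∀ n i → X n (leaves n i)
leaves-X zero    _       = tt
leaves-X (suc n) zero    = leaves-X n zero
leaves-X (suc n) (suc i) = leaves-X n i

leaves-injective : ∀ n → Injective _≡_ _≡_ (leaves n)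
leaves-injective zero    {zero} {zero} _ = refl
leaves-injective (suc n) = ◂-injective (λ _ ()) (leaves-injective n ∘ copy-injective leftSide)

z-adj-leaves : ∀ n {v : VF n} → IsZ n v → ∀ i → EF n v (leaves n i)
z-adj-leaves zero    {center} _ zero    = tt
z-adj-leaves (suc n) {top}    _ zero    = leaves-X n zero
z-adj-leaves (suc n) {top}    _ (suc i) = leaves-X n i

-- The tops z_1, …, z_{n+1} above a leaf x; junk when x is not a leaf.
ancestors : ∀ n → VF n → Fin (suc n) → VF n
ancestors zero    _         _ = center
ancestors (suc n) top       _ = top
ancestors (suc n) (left x)    = top ◂ left ∘ ancestors n x
ancestors (suc n) (right x)   = top ◂ right ∘ ancestors n x

ancestors-adj : ∀ n {x : VF n} → X n x → ∀ i → EF n x (ancestors n x i)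
ancestors-adj zero    {leafL}   _   _       = tt
ancestors-adj zero    {leafR}   _   _       = tt
ancestors-adj (suc n) {left x}  x∈X zero    = x∈X
ancestors-adj (suc n) {left x}  x∈X (suc i) = ancestors-adj n x∈X i
ancestors-adj (suc n) {right x} x∈X zero    = x∈X
ancestors-adj (suc n) {right x} x∈X (suc i) = ancestors-adj n x∈X i

ancestors-injective : ∀ n {x : VF n} → X n x → Injective _≡_ _≡_ (ancestors n x)
ancestors-injective zero    _   {zero} {zero} _ = refl
ancestors-injective (suc n) {left x} x∈X =
  ◂-injective (λ _ ()) (ancestors-injective n x∈X ∘ copy-injective leftSide)
ancestors-injective (suc n) {right x} x∈X =
  ◂-injective (λ _ ()) (ancestors-injective n x∈X ∘ copy-injective rightSide)

¬X⇒neighbour : ∀ n {y : VF n} → ¬ X n y → Σ (VF n) (EF n y)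
¬X⇒neighbour zero    {leafL}   y∉X = ⊥-elim (y∉X tt)
¬X⇒neighbour zero    {leafR}   y∉X = ⊥-elim (y∉X tt)
¬X⇒neighbour zero    {center}  _   = leafL , tt
¬X⇒neighbour (suc n) {top}     _   = left (leaves n zero) , leaves-X n zero
¬X⇒neighbour (suc n) {left y}  y∉X = let w , y~w = ¬X⇒neighbour n y∉X in left w , y~w
¬X⇒neighbour (suc n) {right y} y∉X = let w , y~w = ¬X⇒neighbour n y∉X in right w , y~w

vertexCount : ℕ → ℕ
vertexCount zero    = 3
vertexCount (suc n) = 2 + vertexCount n

distinctVertices : ∀ n → Fin (vertexCount n) → VF n
distinctVertices zero    = leafL ◂ leafR ◂ center ◂ λ ()
distinctVertices (suc n) = top ◂ right (leaves n zero) ◂ left ∘ distinctVertices n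

distinctVertices-injective : ∀ n → Injective _≡_ _≡_ (distinctVertices n)
distinctVertices-injective zero =
  ◂-injective (λ { zero () ; (suc zero) () ; (suc (suc ())) })
    (◂-injective (λ { zero () ; (suc ()) }) (◂-injective (λ ()) λ { {()} }))
distinctVertices-injective (suc n) =
  ◂-injective (λ { zero () ; (suc _) () })
    (◂-injective (λ _ ()) (distinctVertices-injective n ∘ copy-injective leftSide))

vertexCount-large : ∀ n → suc (suc n) + suc (suc n) ≤ 2 + vertexCount n
vertexCount-large zero    = s≤s (s≤s (s≤s (s≤s z≤n)))
vertexCount-large (suc n) =
  subst (_≤ 4 + vertexCount n) (cong suc (sym (+-suc (suc (suc n)) (suc (suc n)))))
        (s≤s (s≤s (vertexCount-large n)))

-- Closed neighbourhoods of F′_{n+1} have at least n + 2 vertices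

Y-nbhd : ∀ n {v : VF n} → Y n v → GameFacts.NbhdOfSize (F′ n) (suc (suc n)) (inj₁ v)
Y-nbhd zero          {leafL}        (v∉X , _) = ⊥-elim (v∉X tt)
Y-nbhd zero          {leafR}        (v∉X , _) = ⊥-elim (v∉X tt)
Y-nbhd zero          {center}       (_ , v≢z) = ⊥-elim (v≢z tt)
Y-nbhd (suc zero)    {top}          (_ , v≢z) = ⊥-elim (v≢z tt)
Y-nbhd (suc zero)    {left leafL}   (v∉X , _) = ⊥-elim (v∉X tt)
Y-nbhd (suc zero)    {left leafR}   (v∉X , _) = ⊥-elim (v∉X tt)
Y-nbhd (suc zero)    {right leafL}  (v∉X , _) = ⊥-elim (v∉X tt)
Y-nbhd (suc zero)    {right leafR}  (v∉X , _) = ⊥-elim (v∉X tt)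
Y-nbhd (suc zero)    {left center}  _ =
  GameFacts.withSelf (F′ 1) (EF′-irreflexive 1) {k = 2} {f = inj₁ (left leafL) ◂ inj₁ (left leafR) ◂ λ ()}
    (◂-injective (λ { zero () ; (suc ()) }) (◂-injective (λ ()) λ { {()} })) λ { zero → tt ; (suc zero) → tt }
Y-nbhd (suc zero)    {right center} _ =
  GameFacts.withSelf (F′ 1) (EF′-irreflexive 1) {k = 2} {f = inj₁ (right leafL) ◂ inj₁ (right leafR) ◂ λ ()}
    (◂-injective (λ { zero () ; (suc ()) }) (◂-injective (λ ()) λ { {()} })) λ { zero → tt ; (suc zero) → tt }
Y-nbhd (suc (suc m)) {v} (v∉X , v≢z) =
  let w , v~w = ¬X⇒neighbour _ {v} v∉X in
  GameFacts.withSelf (F′ (suc (suc m))) (EF′-irreflexive _) {f = inj₁ w ◂ inj₂}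
    (◂-injective (λ _ ()) inj₂-injective) λ { zero → v~w ; (suc _) → v∉X , v≢z }

Y⁺-InN : ∀ m (i j : Fin (suc (suc m))) → Game.InN (F′ (suc (suc m))) (inj₂ i) (inj₂ j)
Y⁺-InN m i j with i ≟ᶠ j
... | yes refl = inj₁ refl
... | no i≢j   = inj₂ i≢j

Y⁺-nbhd : ∀ m i → GameFacts.NbhdOfSize (F′ (suc (suc m))) (suc (suc (suc (suc m)))) (inj₂ i)
Y⁺-nbhd m i =
  inj₁ (left top) ◂ inj₁ (right top) ◂ inj₂ ,
  ◂-injective (λ { zero () ; (suc _) () }) (◂-injective (λ _ ()) inj₂-injective) ,
  λ { zero → inj₂ ((λ ()) , (λ ())) ; (suc zero) → inj₂ ((λ ()) , (λ ())) ; (suc (suc j)) → Y⁺-InN m i j }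

closedNbhd-size : ∀ n (v : V′ n) → GameFacts.NbhdOfSize (F′ n) (suc (suc n)) v
closedNbhd-size n (inj₁ v) with X? n v | IsZ? n v
... | yes v∈X | _ =
  GameFacts.withSelf (F′ n) (EF′-irreflexive n) {f = inj₁ ∘ ancestors n v}
    (ancestors-injective n v∈X ∘ inj₁-injective) (ancestors-adj n v∈X)
... | no _    | yes v≡z =
  GameFacts.withSelf (F′ n) (EF′-irreflexive n) {f = inj₁ ∘ leaves n}
    (leaves-injective n ∘ inj₁-injective) (z-adj-leaves n v≡z)
... | no v∉X  | no v≢z = Y-nbhd n (v∉X , v≢z)
closedNbhd-size (suc (suc m)) (inj₂ i) = Y⁺-nbhd m i

F′-¬SWinS-short : ∀ n m → m < suc (suc n) → ¬ Game.SWinS (F′ n) m [] []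
F′-¬SWinS-short n m m<n+2 =
  GameFacts.¬SWinS-short (F′ n) (closedNbhd-size n) (≡-dec _≟V_ _≟ᶠ_)
    {f = inj₁ ∘ distinctVertices n} (distinctVertices-injective n ∘ inj₁-injective)
    (vertexCount-large n) m m<n+2 z≤n

-- Staller wins the S-game on F′_{n+1} in n + 2 moves

leafAvoiding : (w : VF 0) → Σ (VF 0) (λ x → X 0 x × x ≢ w)
leafAvoiding leafL  = leafR , tt , λ ()
leafAvoiding leafR  = leafL , tt , λ ()
leafAvoiding center = leafL , tt , λ ()

sideAvoiding : ∀ {j} (w : VF (suc j)) → Σ Side (λ σ → ∀ w′ → copy σ w′ ≢ w)
sideAvoiding top       = leftSide  , λ _ ()
sideAvoiding (left _)  = rightSide , λ _ ()
sideAvoiding (right _) = leftSide  , λ _ ()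

leaf≢center : ∀ {x : VF 0} → X 0 x → x ≢ center
leaf≢center {leafL} _ ()
leaf≢center {leafR} _ ()

P₃-leaf-nbhd : ∀ {x w : VF 0} → X 0 x → Game.InN (F 0) x w → w ≡ x ⊎ w ≡ center
P₃-leaf-nbhd                  _ (inj₁ w≡x) = inj₁ w≡x
P₃-leaf-nbhd {leafL} {center} _ (inj₂ _) = inj₂ refl
P₃-leaf-nbhd {leafR} {center} _ (inj₂ _) = inj₂ refl
P₃-leaf-nbhd {leafL} {leafL}  _ (inj₂ ())
P₃-leaf-nbhd {leafL} {leafR}  _ (inj₂ ())
P₃-leaf-nbhd {leafR} {leafL}  _ (inj₂ ())
P₃-leaf-nbhd {leafR} {leafR}  _ (inj₂ ())

module StallerStrategy (n : ℕ) where
  open Game (F′ n)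
  open GameFacts (F′ n)

  -- C is a copy of F_{j+1} inside F′_{n+1}, untouched by both players, such that every
  -- neighbour of one of its leaves outside the copy has been played by Staller.
  record Copy (j : ℕ) (C : VF j → V′ n) (D S : List (V′ n)) : Set where
    field
      injective : Injective _≡_ _≡_ C
      image?    : ∀ v → Σ (VF j) (λ w → v ≡ C w) ⊎ (∀ w → v ≢ C w)
      ∉D        : ∀ w → C w ∉ D
      ∉S        : ∀ w → C w ∉ S
      disjoint  : ∀ {v} → v ∈ S → v ∉ D
      leaf-nbhd : ∀ {x} → X j x → ∀ u → InN (C x) u →
                  Σ (VF j) (λ w → u ≡ C w × Game.InN (F j) x w) ⊎ u ∈ S

  initialCopy : Copy n inj₁ [] []
  initialCopy = record
    { injective = inj₁-injective
    ; image?    = λ { (inj₁ v) → inj₁ (v , refl) ; (inj₂ _) → inj₂ (λ _ ()) }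
    ; ∉D        = λ _ ()
    ; ∉S        = λ _ ()
    ; disjoint  = λ ()
    ; leaf-nbhd = leaf-nbhd }
    where
    leaf-nbhd : ∀ {x} → X n x → ∀ u → InN (inj₁ x) u →
                Σ (VF n) (λ w → u ≡ inj₁ w × Game.InN (F n) x w) ⊎ u ∈ []
    leaf-nbhd _   (inj₁ w) (inj₁ refl)        = inj₁ (w , refl , inj₁ refl)
    leaf-nbhd _   (inj₁ w) (inj₂ x~w)         = inj₁ (w , refl , inj₂ x~w)
    leaf-nbhd _   (inj₂ _) (inj₁ ())
    leaf-nbhd x∈X (inj₂ _) (inj₂ (x∉X , _)) = ⊥-elim (x∉X x∈X)

  copy-undominated : ∀ {j C D S} → Copy j C D S → ¬ DomWon D
  copy-undominated {j} {C} c = ¬DomWon-if-undominated (C (leaves j zero)) undominated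
    where
    open Copy c
    undominated : ∀ u → InN (C (leaves j zero)) u → u ∉ _
    undominated u x~u with leaf-nbhd (leaves-X j zero) u x~u
    ... | inj₁ (w , refl , _) = ∉D w
    ... | inj₂ u∈S            = disjoint u∈S

  copySideAvoiding : ∀ {j C D S} → Copy (suc j) C D S → ∀ d → Σ Side (λ σ → ∀ w → C (copy σ w) ≢ d)
  copySideAvoiding c d with Copy.image? c d
  ... | inj₁ (w , d≡Cw) =
    let σ , avoids = sideAvoiding w in σ , λ w′ e → avoids w′ (Copy.injective c (trans e d≡Cw))
  ... | inj₂ d∉C = leftSide , λ w e → d∉C (copy leftSide w) (sym e)

  copyLeafAvoiding : ∀ {C D S} → Copy 0 C D S → ∀ d → Σ (VF 0) (λ x → X 0 x × C x ≢ d)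
  copyLeafAvoiding c d with Copy.image? c d
  ... | inj₁ (w , d≡Cw) =
    let x , x∈X , x≢w = leafAvoiding w in x , x∈X , λ e → x≢w (Copy.injective c (trans e d≡Cw))
  ... | inj₂ d∉C = leafL , tt , λ e → d∉C leafL (sym e)

  descend : ∀ {j C D S} → Copy (suc j) C D S → ∀ σ {d} → (∀ w → C (copy σ w) ≢ d) →
            d ∉ C top ∷ S → Copy j (C ∘ copy σ) (d ∷ D) (C top ∷ S)
  descend {j} {C} {D} {S} c σ {d} avoids d∉S′ = record
    { injective = copy-injective σ ∘ injective
    ; image?    = image?′
    ; ∉D        = λ { w (here e) → avoids w e ; w (there w∈D) → ∉D (copy σ w) w∈D }
    ; ∉S        = λ { w (here e) → copy-≢top σ w (injective e) ; w (there w∈S) → ∉S (copy σ w) w∈S }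
    ; disjoint  = disjoint′
    ; leaf-nbhd = leaf-nbhd′ }
    where
    open Copy c
    image?′ : ∀ v → Σ (VF j) (λ w → v ≡ C (copy σ w)) ⊎ (∀ w → v ≢ C (copy σ w))
    image?′ v with image? v
    ... | inj₂ v∉C = inj₂ (λ w → v∉C (copy σ w))
    ... | inj₁ (w , refl) with copy-image? σ w
    ...   | inj₁ (w′ , refl) = inj₁ (w′ , refl)
    ...   | inj₂ w∉σ        = inj₂ (λ w′ e → w∉σ w′ (injective e))
    disjoint′ : ∀ {v} → v ∈ C top ∷ S → v ∉ d ∷ D
    disjoint′ (here v≡top) (here v≡d)  = d∉S′ (here (trans (sym v≡d) v≡top))
    disjoint′ (here v≡top) (there v∈D) = ∉D top (subst (_∈ D) v≡top v∈D)
    disjoint′ (there v∈S)  (here v≡d)  = d∉S′ (there (subst (_∈ S) v≡d v∈S))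
    disjoint′ (there v∈S)  (there v∈D) = disjoint v∈S v∈D
    leaf-nbhd′ : ∀ {x} → X j x → ∀ u → InN (C (copy σ x)) u →
                 Σ (VF j) (λ w → u ≡ C (copy σ w) × Game.InN (F j) x w) ⊎ u ∈ C top ∷ S
    leaf-nbhd′ {x} x∈X u x~u with leaf-nbhd (copy-X σ x∈X) u x~u
    ... | inj₂ u∈S = inj₂ (there u∈S)
    ... | inj₁ (w , refl , x~w) with copy-nbhd σ x w x~w
    ...   | inj₁ (w′ , refl , x~w′) = inj₁ (w′ , refl , x~w′)
    ...   | inj₂ refl              = inj₂ (here refl)

  leaf-closedNbhd : ∀ {C D S x} → Copy 0 C D S → X 0 x → ∀ u → InN (C x) u → u ∈ C x ∷ C center ∷ S
  leaf-closedNbhd c x∈X u x~u with Copy.leaf-nbhd c x∈X u x~u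
  ... | inj₂ u∈S = there (there u∈S)
  ... | inj₁ (w , refl , x~w) with P₃-leaf-nbhd x∈X x~w
  ...   | inj₁ refl = here refl
  ...   | inj₂ refl = there (here refl)

  lastMoves : ∀ {C D S} → Copy 0 C D S → ∀ d → Free D (C center ∷ S) d →
              ¬ DomWon (d ∷ D) × SWinS 1 (d ∷ D) (C center ∷ S)
  lastMoves {C} {D} {S} c d (_ , d∉S′) with copyLeafAvoiding c d
  ... | x , x∈X , Cx≢d =
    ¬DomWon-if-undominated (C x) (λ u x~u → unplayed (leaf-closedNbhd c x∈X u x~u)) ,
    C x , (unplayed (here refl) , Cx∉S′) , inj₁ (C x , leaf-closedNbhd c x∈X)
    where
    open Copy c
    unplayed : ∀ {u} → u ∈ C x ∷ C center ∷ S → u ∉ d ∷ D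
    unplayed (here refl)          (here Cx≡d)  = Cx≢d Cx≡d
    unplayed (here refl)          (there Cx∈D) = ∉D x Cx∈D
    unplayed (there u∈S′)         (here u≡d)   = d∉S′ (subst (_∈ C center ∷ S) u≡d u∈S′)
    unplayed (there (here refl))  (there u∈D)  = ∉D center u∈D
    unplayed (there (there u∈S))  (there u∈D)  = disjoint u∈S u∈D
    Cx∉S′ : C x ∉ C center ∷ S
    Cx∉S′ (here e)    = leaf≢center x∈X (injective e)
    Cx∉S′ (there Cx∈S) = ∉S x Cx∈S

  stallerWins : ∀ j {C D S} → Copy j C D S → SWinS (suc (suc j)) D S
  stallerWins zero    {C} c =
    C center , (Copy.∉D c center , Copy.∉S c center) , inj₂ (copy-undominated c , lastMoves c)
  stallerWins (suc j) {C} {D} {S} c =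
    C top , (Copy.∉D c top , Copy.∉S c top) , inj₂ (copy-undominated c , moveDown)
    where
    moveDown : ∀ d → Free D (C top ∷ S) d → ¬ DomWon (d ∷ D) × SWinS (suc (suc j)) (d ∷ D) (C top ∷ S)
    moveDown d (_ , d∉S′) =
      let σ , avoids = copySideAvoiding c d
          c′         = descend c σ avoids d∉S′
      in copy-undominated c′ , stallerWins j c′

-- Dominator wins the D-game on F′_{n+1}

opposite : Side → Side
opposite leftSide  = rightSide
opposite rightSide = leftSide

copy-opposite-≢ : ∀ {j} σ {x y : VF j} → copy (opposite σ) x ≢ copy σ y
copy-opposite-≢ leftSide  ()
copy-opposite-≢ rightSide ()

bothSides : ∀ {A : Side → Set} σ → A σ → A (opposite σ) → ∀ τ → A τ
bothSides leftSide  a _ leftSide  = a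
bothSides leftSide  _ b rightSide = b
bothSides rightSide _ b leftSide  = b
bothSides rightSide a _ rightSide = a

module _ where
  open Game (F′ 0)
  open GameFacts (F′ 0)

  centre-dominates : DomWon (inj₁ center ∷ [])
  centre-dominates (inj₁ leafL)  = inj₁ center , inj₂ tt , here refl
  centre-dominates (inj₁ leafR)  = inj₁ center , inj₂ tt , here refl
  centre-dominates (inj₁ center) = inj₁ center , inj₁ refl , here refl

  dominatorWins-F′₁ : γSMB≡∞
  dominatorWins-F′₁ = ¬SWinD-by-dominating ((λ ()) , (λ ())) centre-dominates

module _ where
  open Game (F′ 1)
  open GameFacts (F′ 1)

  NearCentre : VF 0 → Set
  NearCentre = Game.InN (F 0) center

  other : VF 0 → VF 0
  other leafL  = center
  other leafR  = center
  other center = leafL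

  other-≢ : ∀ w → other w ≢ w
  other-≢ leafL  ()
  other-≢ leafR  ()
  other-≢ center ()

  other-near : ∀ w → NearCentre (other w)
  other-near leafL  = inj₁ refl
  other-near leafR  = inj₁ refl
  other-near center = inj₂ tt

  nearCentreAvoiding : ∀ σ (s : V′ 1) → Σ (VF 0) (λ c → NearCentre c × inj₁ (copy σ c) ≢ s)
  nearCentreAvoiding σ (inj₁ s) with copy-image? σ s
  ... | inj₁ (w , refl) = other w , other-near w , other-≢ w ∘ copy-injective σ ∘ inj₁-injective
  ... | inj₂ s∉σ        = center , inj₁ refl , λ e → s∉σ center (sym (inj₁-injective e))

  F′₂-dominated : ∀ {D} → inj₁ top ∈ D →
                  (∀ τ → Σ (VF 0) (λ c → NearCentre c × inj₁ (copy τ c) ∈ D)) → DomWon D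
  F′₂-dominated {D} top∈D centres = dominated
    where
    inCopy : ∀ τ x → Σ (V′ 1) (λ u → InN (inj₁ (copy τ x)) u × u ∈ D)
    inCopy τ center = let c , near , c∈D = centres τ in inj₁ (copy τ c) , inj₁-InN (copy-InN τ near) , c∈D
    inCopy τ leafL  = inj₁ top , inj₂ (copy-adj-top τ tt) , top∈D
    inCopy τ leafR  = inj₁ top , inj₂ (copy-adj-top τ tt) , top∈D
    dominated : DomWon D
    dominated (inj₁ top)       = inj₁ top , inj₁ refl , top∈D
    dominated (inj₁ (left x))  = inCopy leftSide x
    dominated (inj₁ (right x)) = inCopy rightSide x

  -- Dominator plays z₂, then answers each of Staller's first two moves next to a centre,
  -- first in the copy of P₃ Staller entered and then in the other one.
  dominatorWins-F′₂ : γSMB≡∞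
  dominatorWins-F′₂ = ¬SWinD-by-move ((λ ()) , (λ ())) (¬SWinS-by-answers firstAnswer)
    where
    tooFew : ∀ {S} → length S < 3 → ¬ StaWon S
    tooFew = ¬StaWon-short (closedNbhd-size 1)
    answerInCopy : ∀ σ w m → ¬ SWinD m (inj₁ top ∷ []) (inj₁ (copy σ w) ∷ [])
    answerInCopy σ w = ¬SWinD-by-move free (¬SWinS-by-answers secondAnswer)
      where
      free : Free (inj₁ top ∷ []) (inj₁ (copy σ w) ∷ []) (inj₁ (copy σ (other w)))
      free = (λ { (here e) → copy-≢top σ _ (inj₁-injective e) ; (there ()) }) ,
             (λ { (here e) → other-≢ w (copy-injective σ (inj₁-injective e)) ; (there ()) })
      secondAnswer : ∀ s → Free (inj₁ (copy σ (other w)) ∷ inj₁ top ∷ []) (inj₁ (copy σ w) ∷ []) s →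
                     ¬ StaWon (s ∷ inj₁ (copy σ w) ∷ []) ×
                     (∀ m → ¬ SWinD m (inj₁ (copy σ (other w)) ∷ inj₁ top ∷ []) (s ∷ inj₁ (copy σ w) ∷ []))
      secondAnswer s _ with c , c-near , c≢s ← nearCentreAvoiding (opposite σ) s =
        tooFew (s≤s (s≤s (s≤s z≤n))) ,
        ¬SWinD-by-dominating
          ((λ { (here e)         → copy-opposite-≢ σ (inj₁-injective e)
              ; (there (here e)) → copy-≢top (opposite σ) c (inj₁-injective e)
              ; (there (there ())) }) ,
           (λ { (here e)         → c≢s e
              ; (there (here e)) → copy-opposite-≢ σ (inj₁-injective e)
              ; (there (there ())) }))
          (F′₂-dominated (there (there (here refl)))
            (bothSides σ (other w , other-near w , there (here refl)) (c , c-near , here refl)))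
    firstAnswer : ∀ s → Free (inj₁ top ∷ []) [] s →
                  ¬ StaWon (s ∷ []) × (∀ m → ¬ SWinD m (inj₁ top ∷ []) (s ∷ []))
    firstAnswer (inj₁ top)       (top∉D , _) = ⊥-elim (top∉D (here refl))
    firstAnswer (inj₁ (left w))  _           = tooFew (s≤s (s≤s z≤n)) , answerInCopy leftSide w
    firstAnswer (inj₁ (right w)) _           = tooFew (s≤s (s≤s z≤n)) , answerInCopy rightSide w

module _ (m : ℕ) where
  open Game (F′ (suc (suc m)))
  open GameFacts (F′ (suc (suc m)))

  top-and-Y⁺-dominate : ∀ j → DomWon (inj₂ j ∷ inj₁ top ∷ [])
  top-and-Y⁺-dominate j = dominated
    where
    inCopy : ∀ σ w → Σ (V′ (suc (suc m))) (λ u → InN (inj₁ (copy σ w)) u × u ∈ inj₂ j ∷ inj₁ top ∷ [])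
    inCopy σ w with X? (suc m) w
    ... | yes w∈X = inj₁ top , inj₂ (copy-adj-top σ w∈X) , there (here refl)
    ... | no w∉X  = inj₂ j , inj₂ (copy-Y σ w∉X) , here refl
    dominated : DomWon (inj₂ j ∷ inj₁ top ∷ [])
    dominated (inj₁ top)       = inj₁ top , inj₁ refl , there (here refl)
    dominated (inj₁ (left w))  = inCopy leftSide w
    dominated (inj₁ (right w)) = inCopy rightSide w
    dominated (inj₂ i)         = inj₂ j , Y⁺-InN m i j , here refl

  Y⁺-avoiding : (s : V′ (suc (suc m))) → Σ (Fin (suc (suc m))) (λ j → inj₂ j ≢ s)
  Y⁺-avoiding (inj₁ _)       = zero , λ ()
  Y⁺-avoiding (inj₂ zero)    = suc zero , λ ()
  Y⁺-avoiding (inj₂ (suc _)) = zero , λ ()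

  dominatorWins-Y⁺ : γSMB≡∞
  dominatorWins-Y⁺ = ¬SWinD-by-move ((λ ()) , (λ ())) (¬SWinS-by-answers answer)
    where
    answer : ∀ s → Free (inj₁ top ∷ []) [] s →
             ¬ StaWon (s ∷ []) × (∀ m → ¬ SWinD m (inj₁ top ∷ []) (s ∷ []))
    answer s _ with j , j≢s ← Y⁺-avoiding s =
      ¬StaWon-short (closedNbhd-size (suc (suc m))) (s≤s (s≤s z≤n)) ,
      ¬SWinD-by-dominating ((λ { (here ()) ; (there ()) }) , (λ { (here e) → j≢s e ; (there ()) }))
                           (top-and-Y⁺-dominate j)

dominatorWins : ∀ n → Game.γSMB≡∞ (F′ n)
dominatorWins zero          = dominatorWins-F′₁
dominatorWins (suc zero)    = dominatorWins-F′₂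
dominatorWins (suc (suc m)) = dominatorWins-Y⁺ m

lemma3p1 : (n : ℕ) → Game.γ′SMB≡ (F′ n) (suc (suc n)) × Game.γSMB≡∞ (F′ n)
lemma3p1 n =
  (StallerStrategy.stallerWins n n (StallerStrategy.initialCopy n) , F′-¬SWinS-short n) ,
  dominatorWins n
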